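{- Let $G$ be a $\kappa$-minimal graph with $\kappa \ge \Delta(G) + 1$. If $v_0$ is a vertex of degree $2$ in $G$, then $v_0$ is contained in a triangle of $G$.
   Context: All graphs are finite and simple. An acyclic edge coloring of a graph is a proper edge coloring with no cycle whose edges use only two colors; $\chi_a'(G)$ is the least number of colors in such a coloring. A graph $G$ with maximum degree at most $\kappa$ is $\kappa$-minimal if $\chi_a'(G) > \kappa$ and $\chi_a'(H) \le \kappa$ for every proper minor $H$ of $G$ with $\Delta(H) \le \Delta(G)$. $\Delta(G)$ is the maximum degree of $G$. -}

module Defs where

open import Data.Nat using (ℕ; zero; suc; _+_; _⊔_; _≤_)
open import Data.Fin using (Fin; zero; suc; inject₁; fromℕ)
open import Data.Bool using (Bool; true; false; if_then_else_)
open import Data.Maybe using (Maybe; just; nothing)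
open import Data.List using (List; map; foldr; allFin)
open import Data.Nat.ListAction using (sum)
open import Data.Product using (Σ; ∃; ∃-syntax; _×_; _,_)
open import Data.Sum using (_⊎_)
open import Relation.Nullary using (¬_)
open import Relation.Binary.PropositionalEquality using (_≡_; _≢_)

record Graph : Set where
  field
    n     : ℕ
    adj   : Fin n → Fin n → Bool
    sym   : ∀ x y → adj x y ≡ adj y x
    irr   : ∀ x → adj x x ≡ false
open Graph public

Adj : (G : Graph) → Fin (n G) → Fin (n G) → Set
Adj G x y = adj G x y ≡ true

deg : (G : Graph) → Fin (n G) → ℕ
deg G v = sum (map (λ u → if adj G v u then 1 else 0) (allFin (n G)))

Δ : Graph → ℕ
Δ G = foldr _⊔_ 0 (map (deg G) (allFin (n G)))

record EdgeColouring (G : Graph) (k : ℕ) : Set where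
  field
    col  : Fin (n G) → Fin (n G) → Fin k
    csym : ∀ x y → Adj G x y → col x y ≡ col y x
open EdgeColouring public

Proper : ∀ {G k} → EdgeColouring G k → Set
Proper {G} c = ∀ x y z → Adj G x y → Adj G x z → y ≢ z → col c x y ≢ col c x z

-- A cycle of length (3 + l) in G: distinct vertices w 0, …, w (l+2)
-- with consecutive ones adjacent and w (l+2) adjacent to w 0.
record Cycle (G : Graph) : Set where
  field
    l      : ℕ
    w      : Fin (suc (suc (suc l))) → Fin (n G)
    inj    : ∀ i j → w i ≡ w j → i ≡ j
    path   : ∀ (i : Fin (suc (suc l))) → Adj G (w (inject₁ i)) (w (suc i))
    close  : Adj G (w (fromℕ (suc (suc l)))) (w zero)
open Cycle public

Bichromatic : ∀ {G k} → EdgeColouring G k → Cycle G → Set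
Bichromatic {G} {k} c C = ∃[ a ] ∃[ b ]
  ( (∀ (i : Fin (suc (suc (l C)))) →
       let x = col c (w C (inject₁ i)) (w C (suc i)) in (x ≡ a ⊎ x ≡ b))
  × (let x = col c (w C (fromℕ (suc (suc (l C))))) (w C zero) in (x ≡ a ⊎ x ≡ b)) )

Acyclic : ∀ {G k} → EdgeColouring G k → Set
Acyclic {G} c = Proper c × (∀ (C : Cycle G) → ¬ Bichromatic c C)

AcyclicColourable : Graph → ℕ → Set
AcyclicColourable G k = Σ (EdgeColouring G k) Acyclic

data WalkIn (G : Graph) (P : Fin (n G) → Set) : Fin (n G) → Fin (n G) → Set where
  here : ∀ {x} → WalkIn G P x x
  step : ∀ {x y z} → Adj G x y → P y → WalkIn G P y z → WalkIn G P x z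

-- H is a minor of G: a minor model with disjoint nonempty connected
-- branch sets (β x = just u means x lies in the branch set of u), and
-- every edge of H realised by an edge of G between the branch sets.
record Minor (H G : Graph) : Set where
  field
    β         : Fin (n G) → Maybe (Fin (n H))
    nonempty  : ∀ u → ∃[ x ] (β x ≡ just u)
    connected : ∀ u x y → β x ≡ just u → β y ≡ just u →
                WalkIn G (λ z → β z ≡ just u) x y
    edges     : ∀ u v → Adj H u v →
                ∃[ x ] ∃[ y ] (β x ≡ just u × β y ≡ just v × Adj G x y)

record Iso (H G : Graph) : Set where
  field
    f   : Fin (n H) → Fin (n G)
    g   : Fin (n G) → Fin (n H)
    gf  : ∀ u → g (f u) ≡ u
    fg  : ∀ x → f (g x) ≡ x
    pres : ∀ u v → adj H u v ≡ adj G (f u) (f v)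

ProperMinor : Graph → Graph → Set
ProperMinor H G = Minor H G × ¬ Iso H G

Minimal : ℕ → Graph → Set
Minimal κ G = (Δ G ≤ κ)
            × ¬ AcyclicColourable G κ
            × (∀ (H : Graph) → ProperMinor H G → Δ H ≤ Δ G → AcyclicColourable H κ)

-- Suppose the two neighbours U, W of v₀ are not adjacent. Contracting the edge v₀U turns G into
-- H = (G − v₀) + UW, a proper minor with Δ(H) ≤ Δ(G), so H has an acyclic κ-edge-colouring. As
-- deg_H U ≤ Δ(G) < κ, a colour a is missing at U in H. Colour G as H, with v₀U coloured a and v₀W
-- coloured like UW. This colouring is proper, and a bichromatic cycle of G either avoids v₀, and so
-- is a bichromatic cycle of H, or runs U–v₀–W and leaves U along an edge whose colour is neither a
-- nor that of UW. Hence G is acyclically κ-colourable, contradicting minimality.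
module Submission where

import Algebra.Properties.CommutativeMonoid.Sum as MonoidSum
open import Data.Bool using (Bool; true; false; if_then_else_)
import Data.Bool.Properties as Bool
open import Data.Empty using (⊥; ⊥-elim)
open import Data.Fin using (Fin; zero; suc; punchIn; punchOut; toℕ; inject₁; fromℕ)
open import Data.Fin.Properties
  using ( _≟_; any?; suc-injective; punchIn-injective; punchOut-injective; punchOut-cong
        ; punchOut-punchIn; punchInᵢ≢i; punchIn-punchOut; ¬∀⟶∃¬; pigeonhole)
open import Data.Fin.Relation.Unary.Top using (view; ‵fromℕ; ‵inject₁)
open import Data.List using (tabulate)
open import Data.List.Properties using (foldr-preservesᵇ; foldr-preservesᵒ; map-tabulate)
open import Data.List.Membership.Propositional.Properties using (∈-allFin)
import Data.List.Relation.Unary.All.Properties as All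
import Data.List.Relation.Unary.Any as Any
import Data.List.Relation.Unary.Any.Properties as Any
open import Data.Maybe using (just)
open import Data.Maybe.Properties using (just-injective)
open import Data.Nat using (ℕ; zero; suc; _+_; _⊔_; _≤_; _<_; z≤n; s≤s)
import Data.Nat.Properties as ℕ
open import Data.Nat.Properties
  using ( +-0-commutativeMonoid; 1+n≢0; n<1+n; ≤-refl; ≤-trans; <-irrefl; ≤-<-trans
        ; m≤n⇒m≤n⊔o; m≤n⇒m≤o⊔n; ⊔-lub)
open import Data.Nat.ListAction using (sum)
open import Data.Product using (∃-syntax; _×_; _,_; proj₁; proj₂)
open import Data.Sum using (_⊎_; inj₁; inj₂; [_,_])
open import Function using (_∘_; case_of_)
open import Function.Bundles using (mk⇔)
open import Relation.Nullary using (¬_; Dec; yes; no; does; _×-dec_; _⊎-dec_; ¬?)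
open import Relation.Nullary.Decidable using (dec-true; dec-false; does-⇔)
open import Relation.Binary.PropositionalEquality
  using (_≡_; _≢_; refl; sym; trans; cong; subst; subst₂)

open import Defs hiding (sym)

import Algebra.Properties.CommutativeMonoid.Sum as MonoidSum
module ℕ-Sum = MonoidSum +-0-commutativeMonoid

≡-or-punchIn : ∀ {k} (a x : Fin (suc k)) → x ≡ a ⊎ ∃[ y ] x ≡ punchIn a y
≡-or-punchIn a x with a ≟ x
... | yes a≡x = inj₁ (sym a≡x)
... | no a≢x  = inj₂ (punchOut a≢x , sym (punchIn-punchOut a≢x))

_∈⟨_,_⟩ : ∀ {A : Set} → A → A → A → Set
x ∈⟨ α , β ⟩ = x ≡ α ⊎ x ≡ β

indicator : Bool → ℕ
indicator b = if b then 1 else 0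

count : ∀ {k} → (Fin k → Bool) → ℕ
count p = ℕ-Sum.sum (λ j → indicator (p j))

sum-tabulate : ∀ {k} (f : Fin k → ℕ) → sum (tabulate f) ≡ ℕ-Sum.sum f
sum-tabulate {zero}  f = refl
sum-tabulate {suc k} f = cong (f zero +_) (sum-tabulate (λ j → f (suc j)))

count-remove : ∀ {k} (p : Fin (suc k) → Bool) {a} → p a ≡ true →
               count p ≡ suc (count (λ j → p (punchIn a j)))
count-remove p {a} pa = trans (ℕ-Sum.sum-remove {i = a} (λ j → indicator (p j)))
                              (cong (λ b → indicator b + count (λ j → p (punchIn a j))) pa)

count-true : ∀ k → count {k} (λ _ → true) ≡ k
count-true zero    = refl
count-true (suc k) = cong suc (count-true k)

count-mono : ∀ {k m} (p : Fin k → Bool) (q : Fin m → Bool)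
             (h : ∀ a → p a ≡ true → Fin m) →
             (∀ a b pa pb → h a pa ≡ h b pb → a ≡ b) →
             (∀ a pa → q (h a pa) ≡ true) →
             count p ≤ count q
count-mono {zero} p q h h-inj h-into = z≤n
count-mono {suc k} p q h h-inj h-into with p zero in p₀
... | false = count-mono (λ a → p (suc a)) q (λ a pa → h (suc a) pa)
                (λ a b pa pb e → suc-injective (h-inj (suc a) (suc b) pa pb e))
                (λ a pa → h-into (suc a) pa)
count-mono {suc k} {zero} p q h h-inj h-into | true with h zero p₀
... | ()
count-mono {suc k} {suc m} p q h h-inj h-into | true =
  subst (suc (count (λ a → p (suc a))) ≤_) (sym (count-remove q (h-into zero p₀)))
    (s≤s (count-mono (λ a → p (suc a)) (λ j → q (punchIn c j)) h′ h′-inj h′-into))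
  where
  c : Fin (suc m)
  c = h zero p₀
  c≢ : ∀ a pa → c ≢ h (suc a) pa
  c≢ a pa e with h-inj zero (suc a) p₀ pa e
  ... | ()
  h′ : ∀ a → p (suc a) ≡ true → Fin m
  h′ a pa = punchOut (c≢ a pa)
  h′-inj : ∀ a b pa pb → h′ a pa ≡ h′ b pb → a ≡ b
  h′-inj a b pa pb e =
    suc-injective (h-inj (suc a) (suc b) pa pb (punchOut-injective (c≢ a pa) (c≢ b pb) e))
  h′-into : ∀ a pa → q (punchIn c (h′ a pa)) ≡ true
  h′-into a pa = subst (λ x → q x ≡ true) (sym (punchIn-punchOut (c≢ a pa))) (h-into (suc a) pa)

count-pos : ∀ {k} (p : Fin k → Bool) {a} → p a ≡ true → 0 < count p
count-pos {suc k} p pa = subst (0 <_) (sym (count-remove p pa)) (s≤s z≤n)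

count-witness : ∀ {k} (p : Fin k → Bool) → count p ≢ 0 → ∃[ a ] p a ≡ true
count-witness {zero}  p count≢0 = ⊥-elim (count≢0 refl)
count-witness {suc k} p count≢0 with p zero in p₀
... | true  = zero , p₀
... | false with count-witness (λ j → p (suc j)) count≢0
...   | a , pa = suc a , pa

count-suc : ∀ {k n} (p : Fin (suc k) → Bool) → count p ≡ suc n →
            ∃[ a ] (p a ≡ true × count (λ j → p (punchIn a j)) ≡ n)
count-suc p count≡1+n with count-witness p (λ count≡0 → 1+n≢0 (trans (sym count≡1+n) count≡0))
... | a , pa = a , pa , ℕ.suc-injective (trans (sym (count-remove p pa)) count≡1+n)

count≡2 : ∀ {k} (p : Fin k → Bool) → count p ≡ 2 →
          ∃[ a ] ∃[ b ] (a ≢ b × p a ≡ true × p b ≡ true × (∀ x → p x ≡ true → x ∈⟨ a , b ⟩))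
count≡2 {zero} p ()
count≡2 {suc zero} p count≡2 with count-suc p count≡2
... | _ , _ , ()
count≡2 {suc (suc k)} p count≡2 with count-suc p count≡2
... | a , pa , count′≡1 with count-suc (λ j → p (punchIn a j)) count′≡1
...   | t , pt , count″≡0 = a , punchIn a t , (λ e → punchInᵢ≢i a t (sym e)) , pa , pt , only
  where
  only : ∀ x → p x ≡ true → x ∈⟨ a , punchIn a t ⟩
  only x px with ≡-or-punchIn a x
  ... | inj₁ x≡a = inj₁ x≡a
  ... | inj₂ (y , refl) with ≡-or-punchIn t y
  ...   | inj₁ refl = inj₂ refl
  ...   | inj₂ (z , refl) =
    ⊥-elim (<-irrefl (sym count″≡0) (count-pos (λ j → p (punchIn a (punchIn t j))) px))

deg≡count : ∀ G x → deg G x ≡ count (adj G x)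
deg≡count G x = trans (cong sum (map-tabulate (λ y → y) (λ y → indicator (adj G x y))))
                      (sum-tabulate (λ y → indicator (adj G x y)))

deg≤Δ : ∀ G x → deg G x ≤ Δ G
deg≤Δ G x = foldr-preservesᵒ {P = deg G x ≤_} {f = _⊔_}
              (λ a b → [ m≤n⇒m≤n⊔o b , m≤n⇒m≤o⊔n a ]) 0 _
              (inj₂ (Any.map⁺ (Any.map (λ { refl → ≤-refl }) (∈-allFin x))))

Δ≤ : ∀ G {b} → (∀ x → deg G x ≤ b) → Δ G ≤ b
Δ≤ G {b} deg≤b = foldr-preservesᵇ {P = _≤ b} {f = _⊔_} ⊔-lub z≤n (All.map⁺ (All.tabulate⁺ deg≤b))

¬Iso-smaller : ∀ {H G} → n H < n G → ¬ Iso H G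
¬Iso-smaller n<n iso with pigeonhole n<n (Iso.g iso)
... | i , j , i<j , gi≡gj = <-irrefl (cong toℕ i≡j) i<j
  where
  i≡j : i ≡ j
  i≡j = trans (sym (Iso.fg iso i)) (trans (cong (Iso.f iso) gi≡gj) (Iso.fg iso j))

missing-colour : ∀ {G κ} (c : EdgeColouring G κ) x → deg G x < κ →
                 ∃[ a ] (∀ y → Adj G x y → col c x y ≢ a)
missing-colour {G} {κ} c x deg<κ with ¬∀⟶∃¬ κ Used used? not-all-used
  where
  Used : Fin κ → Set
  Used a = ∃[ y ] (Adj G x y × col c x y ≡ a)
  used? : ∀ a → Dec (Used a)
  used? a = any? (λ y → (adj G x y Bool.≟ true) ×-dec (col c x y ≟ a))
  not-all-used : ¬ (∀ a → Used a)
  not-all-used used = <-irrefl refl (≤-<-trans κ≤deg deg<κ)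
    where
    κ≤deg : κ ≤ deg G x
    κ≤deg = subst₂ _≤_ (count-true κ) (sym (deg≡count G x))
              (count-mono (λ _ → true) (adj G x) (λ a _ → proj₁ (used a))
                 (λ a b _ _ e → trans (sym (proj₂ (proj₂ (used a))))
                                  (trans (cong (col c x) e) (proj₂ (proj₂ (used b)))))
                 (λ a _ → proj₁ (proj₂ (used a))))
... | a , unused = a , λ y xy e → unused (y , xy , e)

no-three-in-pair : ∀ {A : Set} {α β x y z : A} → x ∈⟨ α , β ⟩ → y ∈⟨ α , β ⟩ → z ∈⟨ α , β ⟩ →
                   x ≢ y → x ≢ z → y ≢ z → ⊥
no-three-in-pair (inj₁ refl) (inj₁ refl) _           x≢y _   _   = x≢y refl
no-three-in-pair (inj₁ refl) (inj₂ refl) (inj₁ refl) _   x≢z _   = x≢z refl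
no-three-in-pair (inj₁ refl) (inj₂ refl) (inj₂ refl) _   _   y≢z = y≢z refl
no-three-in-pair (inj₂ refl) (inj₂ refl) _           x≢y _   _   = x≢y refl
no-three-in-pair (inj₂ refl) (inj₁ refl) (inj₂ refl) _   x≢z _   = x≢z refl
no-three-in-pair (inj₂ refl) (inj₁ refl) (inj₁ refl) _   _   y≢z = y≢z refl

previous : ∀ {k} → Fin (suc k) → Fin (suc k)
previous zero    = fromℕ _
previous (suc t) = inject₁ t

previous-surjective : ∀ {k} (i : Fin (suc k)) → ∃[ j ] previous j ≡ i
previous-surjective i with view i
... | ‵fromℕ     = zero , refl
... | ‵inject₁ t = suc t , refl

previous²≢id : ∀ {k} (i : Fin (suc (suc (suc k)))) → previous (previous i) ≢ i
previous²≢id zero          ()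
previous²≢id (suc zero)    ()
previous²≢id (suc (suc t)) = inject₁²≢suc² t
  where
  inject₁²≢suc² : ∀ {k} (t : Fin k) → inject₁ (inject₁ t) ≢ suc (suc t)
  inject₁²≢suc² zero    ()
  inject₁²≢suc² (suc t) e = inject₁²≢suc² t (suc-injective e)

Consecutive : ∀ {k} → Fin (suc k) → Fin (suc k) → Set
Consecutive i j = previous j ≡ i ⊎ previous i ≡ j

two-consecutive : ∀ {k} (i : Fin (suc (suc (suc k)))) →
                  ∃[ j ] ∃[ j′ ] (j ≢ j′ × Consecutive i j × Consecutive i j′)
two-consecutive i with previous-surjective i
... | j , previous-j≡i = previous i , j , previous-i≢j , inj₂ refl , inj₁ previous-j≡i
  where
  previous-i≢j : previous i ≢ j
  previous-i≢j previous-i≡j = previous²≢id j (trans (cong previous previous-j≡i) previous-i≡j)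

consecutive-avoiding : ∀ {k} (i p : Fin (suc (suc (suc k)))) → ∃[ j ] (j ≢ i × Consecutive p j)
consecutive-avoiding i p with two-consecutive p
... | j , j′ , j≢j′ , p∼j , p∼j′ with j ≟ i
...   | no j≢i   = j , j≢i , p∼j
...   | yes refl = j′ , (λ j′≡j → j≢j′ (sym j′≡j)) , p∼j′

Adj-sym : ∀ G {x y} → Adj G x y → Adj G y x
Adj-sym G {x} {y} xy = trans (Graph.sym G y x) xy

Adj⇒≢ : ∀ G {x y} → Adj G x y → x ≢ y
Adj⇒≢ G {x} xy refl with trans (sym xy) (irr G x)
... | ()

module _ {G : Graph} (C : Cycle G) where

  previous-adj : ∀ i → Adj G (w C (previous i)) (w C i)
  previous-adj zero    = close C
  previous-adj (suc t) = path C t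

  consecutive-adj : ∀ {i j} → Consecutive i j → Adj G (w C i) (w C j)
  consecutive-adj {j = j} (inj₁ refl) = previous-adj j
  consecutive-adj {i = i} (inj₂ refl) = Adj-sym G (previous-adj i)

  module _ {κ} (c : EdgeColouring G κ) {α β : Fin κ}
           (along : ∀ t → col c (w C (inject₁ t)) (w C (suc t)) ∈⟨ α , β ⟩)
           (closing : col c (w C (fromℕ _)) (w C zero) ∈⟨ α , β ⟩) where

    previous-colour : ∀ i → col c (w C (previous i)) (w C i) ∈⟨ α , β ⟩
    previous-colour zero    = closing
    previous-colour (suc t) = along t

    consecutive-colour : ∀ {i j} → Consecutive i j → col c (w C i) (w C j) ∈⟨ α , β ⟩
    consecutive-colour {j = j} (inj₁ refl) = previous-colour j
    consecutive-colour {i = i} (inj₂ refl) =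
      subst (_∈⟨ α , β ⟩) (csym c _ _ (previous-adj i)) (previous-colour i)

module FromRelation {k} (E : Fin k → Fin k → Set) (E? : ∀ i j → Dec (E i j))
                    (E-sym : ∀ {i j} → E i j → E j i) (E-irr : ∀ {i} → ¬ E i i) where

  graph : Graph
  graph = record
    { n   = k
    ; adj = λ i j → does (E? i j)
    ; sym = λ i j → does-⇔ (mk⇔ E-sym E-sym) (E? i j) (E? j i)
    ; irr = λ i → dec-false (E? i i) E-irr
    }

  Adj⇒E : ∀ {i j} → Adj graph i j → E i j
  Adj⇒E {i} {j} ij with E? i j
  ... | yes e = e

  E⇒Adj : ∀ {i j} → E i j → Adj graph i j
  E⇒Adj {i} {j} = dec-true (E? i j)

module Suppression {m : ℕ} (A : Fin (suc m) → Fin (suc m) → Bool)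
  (A-sym : ∀ x y → A x y ≡ A y x) (A-irr : ∀ x → A x x ≡ false)
  (v₀ : Fin (suc m)) (u : Fin m) (W : Fin (suc m))
  (v₀U : A v₀ (punchIn v₀ u) ≡ true) (v₀W : A v₀ W ≡ true)
  (N[v₀] : ∀ x → A v₀ x ≡ true → x ∈⟨ punchIn v₀ u , W ⟩) (U≢W : punchIn v₀ u ≢ W)
  (U≁W : A (punchIn v₀ u) W ≡ false) where

  G : Graph
  G = record { n = suc m ; adj = A ; sym = A-sym ; irr = A-irr }

  ι : Fin m → Fin (suc m)
  ι = punchIn v₀

  U : Fin (suc m)
  U = ι u

  v₀-neighbours : ∀ {x y} → x ≢ y → Adj G v₀ x → Adj G v₀ y → (x ≡ U × y ≡ W) ⊎ (x ≡ W × y ≡ U)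
  v₀-neighbours {x} {y} x≢y v₀x v₀y with N[v₀] x v₀x | N[v₀] y v₀y
  ... | inj₁ refl | inj₁ refl = ⊥-elim (x≢y refl)
  ... | inj₁ refl | inj₂ refl = inj₁ (refl , refl)
  ... | inj₂ refl | inj₁ refl = inj₂ (refl , refl)
  ... | inj₂ refl | inj₂ refl = ⊥-elim (x≢y refl)

  no-common-neighbour : ∀ {x} → Adj G x v₀ → Adj G x U → ⊥
  no-common-neighbour {x} xv₀ xU with N[v₀] x (Adj-sym G xv₀)
  ... | inj₁ refl = Adj⇒≢ G xU refl
  ... | inj₂ refl with trans (sym (Adj-sym G xU)) U≁W
  ...   | ()

  -- Since N(v₀) = {U, W}, the graph H built from Edgeᴴ is G / v₀U = (G − v₀) + UW.
  Edgeᴴ : Fin m → Fin m → Set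
  Edgeᴴ i j = Adj G (ι i) (ι j) ⊎ (i ≢ j × Adj G (ι i) v₀ × Adj G v₀ (ι j))

  edgeᴴ? : ∀ i j → Dec (Edgeᴴ i j)
  edgeᴴ? i j = (A (ι i) (ι j) Bool.≟ true)
          ⊎-dec (¬? (i ≟ j) ×-dec (A (ι i) v₀ Bool.≟ true) ×-dec (A v₀ (ι j) Bool.≟ true))

  edgeᴴ-sym : ∀ {i j} → Edgeᴴ i j → Edgeᴴ j i
  edgeᴴ-sym (inj₁ ij)              = inj₁ (Adj-sym G ij)
  edgeᴴ-sym (inj₂ (i≢j , iv₀ , v₀j)) =
    inj₂ ((λ j≡i → i≢j (sym j≡i)) , Adj-sym G v₀j , Adj-sym G iv₀)

  edgeᴴ-irr : ∀ {i} → ¬ Edgeᴴ i i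
  edgeᴴ-irr (inj₁ ii)          = Adj⇒≢ G ii refl
  edgeᴴ-irr (inj₂ (i≢i , _ , _)) = i≢i refl

  open FromRelation Edgeᴴ edgeᴴ? edgeᴴ-sym edgeᴴ-irr using (Adj⇒E; E⇒Adj)

  H : Graph
  H = FromRelation.graph Edgeᴴ edgeᴴ? edgeᴴ-sym edgeᴴ-irr

  contract : Fin (suc m) → Fin m
  contract x with v₀ ≟ x
  ... | yes _    = u
  ... | no v₀≢x = punchOut v₀≢x

  centre : Fin m
  centre = contract v₀

  contract-v₀ : contract v₀ ≡ u
  contract-v₀ with v₀ ≟ v₀
  ... | yes _     = refl
  ... | no v₀≢v₀ = ⊥-elim (v₀≢v₀ refl)

  contract-ι : ∀ i → contract (ι i) ≡ i
  contract-ι i with v₀ ≟ ι i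
  ... | yes v₀≡ιi = ⊥-elim (punchInᵢ≢i v₀ i (sym v₀≡ιi))
  ... | no _      = trans (punchOut-cong v₀ refl) (punchOut-punchIn v₀)

  contract-collapse : ∀ {x y} → x ≢ y → contract x ≡ contract y →
                      (x ≡ v₀ × y ≡ U) ⊎ (x ≡ U × y ≡ v₀)
  contract-collapse {x} {y} x≢y same with ≡-or-punchIn v₀ x | ≡-or-punchIn v₀ y
  ... | inj₁ refl       | inj₁ refl       = ⊥-elim (x≢y refl)
  ... | inj₁ refl       | inj₂ (j , refl) =
    inj₁ (refl , cong ι (sym (trans (sym contract-v₀) (trans same (contract-ι j)))))
  ... | inj₂ (i , refl) | inj₁ refl       =
    inj₂ (cong ι (trans (sym (contract-ι i)) (trans same contract-v₀)) , refl)
  ... | inj₂ (i , refl) | inj₂ (j , refl) =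
    ⊥-elim (x≢y (cong ι (trans (sym (contract-ι i)) (trans same (contract-ι j)))))

  contract-adj : ∀ {x y} → Adj G x y → contract x ≢ contract y → Adj H (contract x) (contract y)
  contract-adj {x} {y} xy distinct with ≡-or-punchIn v₀ x | ≡-or-punchIn v₀ y
  ... | inj₁ refl       | inj₁ refl       = ⊥-elim (Adj⇒≢ G xy refl)
  ... | inj₁ refl       | inj₂ (j , refl) =
    subst₂ (Adj H) (sym contract-v₀) (sym (contract-ι j))
      (E⇒Adj (inj₂ ((λ u≡j → distinct (trans contract-v₀ (trans u≡j (sym (contract-ι j)))))
                   , Adj-sym G v₀U , xy)))
  ... | inj₂ (i , refl) | inj₁ refl       =
    subst₂ (Adj H) (sym (contract-ι i)) (sym contract-v₀)
      (E⇒Adj (inj₂ ((λ i≡u → distinct (trans (contract-ι i) (trans i≡u (sym contract-v₀))))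
                   , xy , v₀U)))
  ... | inj₂ (i , refl) | inj₂ (j , refl) =
    subst₂ (Adj H) (sym (contract-ι i)) (sym (contract-ι j)) (E⇒Adj (inj₁ xy))

  lift-edge : ∀ {i j} → Adj H i j → ∃[ x ] ∃[ y ] (contract x ≡ i × contract y ≡ j × Adj G x y)
  lift-edge {i} {j} ij with Adj⇒E ij
  ... | inj₁ ιiιj = ι i , ι j , contract-ι i , contract-ι j , ιiιj
  ... | inj₂ (i≢j , ιiv₀ , v₀ιj)
      with v₀-neighbours (i≢j ∘ punchIn-injective v₀ i j) (Adj-sym G ιiv₀) v₀ιj
  ...   | inj₁ (ιi≡U , _) =
    v₀ , ι j , trans contract-v₀ (sym (punchIn-injective v₀ i u ιi≡U)) , contract-ι j , v₀ιj
  ...   | inj₂ (_ , ιj≡U) =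
    ι i , v₀ , contract-ι i , trans contract-v₀ (sym (punchIn-injective v₀ j u ιj≡U)) , ιiv₀

  minor : Minor H G
  minor = record
    { β         = λ x → just (contract x)
    ; nonempty  = λ i → ι i , cong just (contract-ι i)
    ; connected = connected
    ; edges     = λ i j ij → edge (lift-edge ij)
    }
    where
    connected : ∀ i x y → just (contract x) ≡ just i → just (contract y) ≡ just i →
                WalkIn G (λ z → just (contract z) ≡ just i) x y
    connected i x y βx βy with x ≟ y
    ... | yes refl = here
    ... | no x≢y with contract-collapse x≢y (just-injective (trans βx (sym βy)))
    ...   | inj₁ (refl , refl) = step v₀U βy here
    ...   | inj₂ (refl , refl) = step (Adj-sym G v₀U) βy here
    edge : ∀ {i j} → ∃[ x ] ∃[ y ] (contract x ≡ i × contract y ≡ j × Adj G x y) →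
           ∃[ x ] ∃[ y ] (just (contract x) ≡ just i × just (contract y) ≡ just j × Adj G x y)
    edge (x , y , cx , cy , xy) = x , y , cong just cx , cong just cy , xy

  proper-minor : ProperMinor H G
  proper-minor = minor , ¬Iso-smaller (n<1+n m)

  -- An H-neighbour j of i that is not a G-neighbour of ι i is charged to the edge (ι i, v₀);
  -- as v₀ has only two neighbours, at most one j is charged there.
  charge : ∀ {i j} → Edgeᴴ i j → Fin (suc m)
  charge {j = j} (inj₁ _) = ι j
  charge         (inj₂ _) = v₀

  charge-adj : ∀ {i j} (e : Edgeᴴ i j) → Adj G (ι i) (charge e)
  charge-adj (inj₁ ιiιj)         = ιiιj
  charge-adj (inj₂ (_ , ιiv₀ , _)) = ιiv₀

  charge-injective : ∀ {i j j′} (e : Edgeᴴ i j) (e′ : Edgeᴴ i j′) → charge e ≡ charge e′ → j ≡ j′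
  charge-injective (inj₁ _) (inj₁ _) ιj≡ιj′ = punchIn-injective v₀ _ _ ιj≡ιj′
  charge-injective (inj₁ _) (inj₂ _) ιj≡v₀  = ⊥-elim (punchInᵢ≢i v₀ _ ιj≡v₀)
  charge-injective (inj₂ _) (inj₁ _) v₀≡ιj′ = ⊥-elim (punchInᵢ≢i v₀ _ (sym v₀≡ιj′))
  charge-injective {i} {j} {j′} (inj₂ (i≢j , ιiv₀ , v₀ιj)) (inj₂ (i≢j′ , _ , v₀ιj′)) _ with j ≟ j′
  ... | yes j≡j′ = j≡j′
  ... | no j≢j′  =
    ⊥-elim (no-three-in-pair (N[v₀] _ (Adj-sym G ιiv₀)) (N[v₀] _ v₀ιj) (N[v₀] _ v₀ιj′)
              (i≢j ∘ punchIn-injective v₀ i j) (i≢j′ ∘ punchIn-injective v₀ i j′)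
              (j≢j′ ∘ punchIn-injective v₀ j j′))

  deg-H≤deg-G : ∀ i → deg H i ≤ deg G (ι i)
  deg-H≤deg-G i = subst₂ _≤_ (sym (deg≡count H i)) (sym (deg≡count G (ι i)))
    (count-mono (adj H i) (A (ι i)) (λ j ij → charge (Adj⇒E ij))
      (λ j j′ ij ij′ → charge-injective (Adj⇒E ij) (Adj⇒E ij′))
      (λ j ij → charge-adj (Adj⇒E ij)))

  ΔH≤ΔG : Δ H ≤ Δ G
  ΔH≤ΔG = Δ≤ H (λ i → ≤-trans (deg-H≤deg-G i) (deg≤Δ G (ι i)))

  contract-U : contract U ≡ centre
  contract-U = trans (contract-ι u) (sym contract-v₀)

  contract-injective : ∀ {x y} → v₀ ≢ x → v₀ ≢ y → contract x ≡ contract y → x ≡ y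
  contract-injective {x} {y} v₀≢x v₀≢y same with x ≟ y
  ... | yes x≡y = x≡y
  ... | no x≢y with contract-collapse x≢y same
  ...   | inj₁ (x≡v₀ , _) = ⊥-elim (v₀≢x (sym x≡v₀))
  ...   | inj₂ (_ , y≡v₀) = ⊥-elim (v₀≢y (sym y≡v₀))

  collapse-at-centre : ∀ {x y} → x ≢ y → contract x ≡ contract y → contract x ≡ centre
  collapse-at-centre x≢y same with contract-collapse x≢y same
  ... | inj₁ (refl , _) = refl
  ... | inj₂ (refl , _) = contract-U

  neighbours-stay-apart : ∀ {x y z} → Adj G x y → Adj G x z → y ≢ z → contract y ≢ contract z
  neighbours-stay-apart xy xz y≢z same with contract-collapse y≢z same
  ... | inj₁ (refl , refl) = no-common-neighbour xy xz
  ... | inj₂ (refl , refl) = no-common-neighbour xz xy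

  contract-cycle : (C : Cycle G) → (∀ i → v₀ ≢ w C i) → Cycle H
  contract-cycle C v₀∉C = record
    { l     = l C
    ; w     = λ i → contract (w C i)
    ; inj   = λ i j same → inj C i j (contract-injective (v₀∉C i) (v₀∉C j) same)
    ; path  = λ t → contract-adj (path C t) (apart (path C t))
    ; close = contract-adj (close C) (apart (close C))
    }
    where
    apart : ∀ {i j} → Adj G (w C i) (w C j) → contract (w C i) ≢ contract (w C j)
    apart {i} {j} e = Adj⇒≢ G e ∘ contract-injective (v₀∉C i) (v₀∉C j)

  Near : Fin m → Set
  Near j = j ≡ centre ⊎ Adj H centre j

  near : ∀ {x y} → contract x ≡ centre → Adj G x y → Near (contract y)
  near {x} {y} X≡c xy with contract x ≟ contract y
  ... | yes X≡Y = inj₁ (trans (sym X≡Y) X≡c)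
  ... | no X≢Y  = inj₂ (subst (λ X → Adj H X (contract y)) X≡c (contract-adj xy X≢Y))

  module Extension {κ} (cH : EdgeColouring H κ) (properH : Proper cH) (a : Fin κ)
                   (a-missing : ∀ j → Adj H centre j → col cH centre j ≢ a) where

    -- The contracted edge v₀U becomes the loop at centre, which takes the colour a.
    recolour : Fin m → Fin m → Fin κ
    recolour i j with i ≟ j
    ... | yes _ = a
    ... | no _  = col cH i j

    recolour-≢ : ∀ {i j} → i ≢ j → recolour i j ≡ col cH i j
    recolour-≢ {i} {j} i≢j with i ≟ j
    ... | yes i≡j = ⊥-elim (i≢j i≡j)
    ... | no _    = refl

    recolour-≡ : ∀ {i j} → i ≡ j → recolour i j ≡ a
    recolour-≡ {i} {j} i≡j with i ≟ j
    ... | yes _   = refl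
    ... | no i≢j  = ⊥-elim (i≢j i≡j)

    recolour-separates : ∀ {j j′} → j ≢ j′ → Near j → Near j′ →
                         recolour centre j ≢ recolour centre j′
    recolour-separates j≢j′ (inj₁ j≡c) (inj₁ j′≡c) _ = j≢j′ (trans j≡c (sym j′≡c))
    recolour-separates _ (inj₁ j≡c) (inj₂ cj′) same =
      a-missing _ cj′ (trans (sym (recolour-≢ (Adj⇒≢ H cj′)))
                        (trans (sym same) (recolour-≡ (sym j≡c))))
    recolour-separates _ (inj₂ cj) (inj₁ j′≡c) same =
      a-missing _ cj (trans (sym (recolour-≢ (Adj⇒≢ H cj)))
                       (trans same (recolour-≡ (sym j′≡c))))
    recolour-separates j≢j′ (inj₂ cj) (inj₂ cj′) same =
      properH _ _ _ cj cj′ j≢j′ (trans (sym (recolour-≢ (Adj⇒≢ H cj)))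
                                  (trans same (recolour-≢ (Adj⇒≢ H cj′))))

    recolour-sym : ∀ {i j} → (i ≢ j → Adj H i j) → recolour i j ≡ recolour j i
    recolour-sym {i} {j} ij = case i ≟ j of λ where
      (yes i≡j) → trans (recolour-≡ i≡j) (sym (recolour-≡ (sym i≡j)))
      (no i≢j)  → trans (recolour-≢ i≢j)
                    (trans (csym cH i j (ij i≢j)) (sym (recolour-≢ (i≢j ∘ sym))))

    cG : EdgeColouring G κ
    cG = record { col = λ x y → recolour (contract x) (contract y)
                ; csym = λ x y xy → recolour-sym (contract-adj xy) }

    properG : Proper cG
    properG x y z xy xz y≢z = case contract x ≟ centre of λ where
        (yes X≡c) → at-centre X≡c
        (no X≢c)  → off-centre X≢c
      where
      Y≢Z : contract y ≢ contract z
      Y≢Z = neighbours-stay-apart xy xz y≢z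
      at-centre : contract x ≡ centre → col cG x y ≢ col cG x z
      at-centre X≡c same = recolour-separates Y≢Z (near X≡c xy) (near X≡c xz)
                             (subst (λ X → recolour X (contract y) ≡ recolour X (contract z))
                                    X≡c same)
      off-centre : contract x ≢ centre → col cG x y ≢ col cG x z
      off-centre X≢c = subst₂ _≢_ (sym (recolour-≢ X≢Y)) (sym (recolour-≢ X≢Z))
                         (properH _ _ _ (contract-adj xy X≢Y) (contract-adj xz X≢Z) Y≢Z)
        where
        X≢Y : contract x ≢ contract y
        X≢Y = X≢c ∘ collapse-at-centre (Adj⇒≢ G xy)
        X≢Z : contract x ≢ contract z
        X≢Z = X≢c ∘ collapse-at-centre (Adj⇒≢ G xz)

    trichromatic : ∀ {z α β} → Adj G U z → v₀ ≢ z →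
                   col cG v₀ U ∈⟨ α , β ⟩ → col cG v₀ W ∈⟨ α , β ⟩ → col cG U z ∈⟨ α , β ⟩ → ⊥
    trichromatic {z} {α} {β} Uz v₀≢z v₀U∈ v₀W∈ Uz∈ =
      no-three-in-pair v₀U∈ v₀W∈ (subst (λ X → recolour X (contract z) ∈⟨ α , β ⟩) contract-U Uz∈)
        (recolour-separates (U≢W ∘ contract-injective v₀≢U v₀≢W) (near refl v₀U) (near refl v₀W))
        (recolour-separates (Adj⇒≢ G Uz ∘ contract-injective v₀≢U v₀≢z)
                            (near refl v₀U) (near contract-U Uz))
        (recolour-separates (W≢z ∘ contract-injective v₀≢W v₀≢z)
                            (near refl v₀W) (near contract-U Uz))
      where
      v₀≢U : v₀ ≢ U
      v₀≢U = Adj⇒≢ G v₀U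
      v₀≢W : v₀ ≢ W
      v₀≢W = Adj⇒≢ G v₀W
      W≢z : W ≢ z
      W≢z refl with trans (sym Uz) U≁W
      ... | ()

    acyclicG : (∀ C → ¬ Bichromatic cH C) → ∀ C → ¬ Bichromatic cG C
    acyclicG acyclicH C (α , β , along , closing) = case any? (λ i → w C i ≟ v₀) of λ where
        (no v₀∉C)        → avoiding (λ i v₀≡wi → v₀∉C (i , sym v₀≡wi))
        (yes (i , wi≡v₀)) → through i wi≡v₀
      where
      avoiding : (∀ i → v₀ ≢ w C i) → ⊥
      avoiding v₀∉C = acyclicH (contract-cycle C v₀∉C)
                        (α , β , (λ t → transfer (path C t) (along t)) , transfer (close C) closing)
        where
        transfer : ∀ {i j} → Adj G (w C i) (w C j) → col cG (w C i) (w C j) ∈⟨ α , β ⟩ →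
                   col cH (contract (w C i)) (contract (w C j)) ∈⟨ α , β ⟩
        transfer {i} {j} e = subst (_∈⟨ α , β ⟩)
                               (recolour-≢ (Adj⇒≢ G e ∘ contract-injective (v₀∉C i) (v₀∉C j)))

      cycle-colour : ∀ {i j x y} → Consecutive i j → w C i ≡ x → w C j ≡ y → col cG x y ∈⟨ α , β ⟩
      cycle-colour i∼j refl refl = consecutive-colour C cG along closing i∼j

      cycle-adj : ∀ {i j x y} → Consecutive i j → w C i ≡ x → w C j ≡ y → Adj G x y
      cycle-adj i∼j refl refl = consecutive-adj C i∼j

      through-U : ∀ {i p q} → w C i ≡ v₀ → Consecutive i p → Consecutive i q →
                  w C p ≡ U → w C q ≡ W → ⊥
      through-U {i} {p} wi≡v₀ i∼p i∼q wp≡U wq≡W with consecutive-avoiding i p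
      ... | k , k≢i , p∼k =
        trichromatic (cycle-adj p∼k wp≡U refl)
          (λ v₀≡wk → k≢i (inj C k i (trans (sym v₀≡wk) (sym wi≡v₀))))
          (cycle-colour i∼p wi≡v₀ wp≡U) (cycle-colour i∼q wi≡v₀ wq≡W) (cycle-colour p∼k wp≡U refl)

      through : ∀ i → w C i ≡ v₀ → ⊥
      through i wi≡v₀ with two-consecutive i
      ... | j , j′ , j≢j′ , i∼j , i∼j′
          with v₀-neighbours (j≢j′ ∘ inj C j j′)
                 (cycle-adj i∼j wi≡v₀ refl) (cycle-adj i∼j′ wi≡v₀ refl)
      ...   | inj₁ (wj≡U , wj′≡W) = through-U wi≡v₀ i∼j i∼j′ wj≡U wj′≡W
      ...   | inj₂ (wj≡W , wj′≡U) = through-U wi≡v₀ i∼j′ i∼j wj′≡U wj≡W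

  extend-colouring : ∀ {κ} → Δ G < κ → AcyclicColourable H κ → AcyclicColourable G κ
  extend-colouring Δ<κ (cH , properH , acyclicH)
    with missing-colour cH centre (≤-<-trans (≤-trans (deg≤Δ H centre) ΔH≤ΔG) Δ<κ)
  ... | a , a-missing = cG , properG , acyclicG acyclicH
    where open Extension cH properH a a-missing

lemma13 : (κ : ℕ) (G : Graph) → Minimal κ G → suc (Δ G) ≤ κ →
          (v₀ : Fin (n G)) → deg G v₀ ≡ 2 →
          ∃[ u ] ∃[ w ] (Adj G v₀ u × Adj G v₀ w × Adj G u w)
lemma13 κ record { n = zero } _ _ () _
lemma13 κ G@record { n = suc m ; adj = A ; sym = A-sym ; irr = A-irr }
        (_ , ¬colourable , minimal) Δ<κ v₀ deg≡2
  with count≡2 (A v₀) (trans (sym (deg≡count G v₀)) deg≡2)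
... | U , W , U≢W , v₀U , v₀W , N[v₀] with A U W in UW
...   | true  = U , W , v₀U , v₀W , UW
...   | false with ≡-or-punchIn v₀ U
...     | inj₁ refl = ⊥-elim (Adj⇒≢ G v₀U refl)
...     | inj₂ (u , refl) =
  let open Suppression A A-sym A-irr v₀ u W v₀U v₀W N[v₀] U≢W UW
  in ⊥-elim (¬colourable (extend-colouring Δ<κ (minimal H proper-minor ΔH≤ΔG)))
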